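{- Supraclassicality holds in $\mathsf{DF/TT}$: for all formulae $A,B$, if $A\models_{\mathsf{CL}}B$ then $\models_{\mathsf{DF/TT}}A\to B$.
   Context: Formulae are built from propositional variables with $\neg,\wedge,\vee,\to$. A $\mathsf{DF}$-evaluation is a map $v$ from formulae to $\{0,\tfrac12,1\}$ with $v(\neg A)=1-v(A)$, $v(A\wedge B)=\min(v(A),v(B))$, $v(A\vee B)=\max(v(A),v(B))$, and $v(A\to B)=v(B)$ if $v(A)=1$, $v(A\to B)=\tfrac12$ otherwise. $\models_{\mathsf{DF/TT}}C$ means $v(C)\in\{\tfrac12,1\}$ for every $\mathsf{DF}$-evaluation $v$. $A\models_{\mathsf{CL}}B$ denotes classical two-valued consequence on the same language (every classical valuation making $A$ true makes $B$ true), where $\to$ is interpreted classically as the material conditional. -}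

module Defs where

open import Data.Nat using (ℕ)
open import Data.Bool using (Bool; true; false; not; _∧_; _∨_)
open import Data.Product using (_×_)
open import Data.Sum using (_⊎_)
open import Relation.Binary.PropositionalEquality using (_≡_)

data Formula : Set where
  var  : ℕ → Formula
  ¬'_  : Formula → Formula
  _∧'_ : Formula → Formula → Formula
  _∨'_ : Formula → Formula → Formula
  _⇒_  : Formula → Formula → Formula

-- The three truth values 0, 1/2, 1
data V3 : Set where
  v0 vh v1 : V3

neg3 : V3 → V3
neg3 v0 = v1
neg3 vh = vh
neg3 v1 = v0

min3 : V3 → V3 → V3
min3 v0 _  = v0
min3 vh v0 = v0
min3 vh _  = vh
min3 v1 b  = b

max3 : V3 → V3 → V3
max3 v1 _  = v1
max3 vh v1 = v1
max3 vh _  = vh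
max3 v0 b  = b

imp3 : V3 → V3 → V3
imp3 v1 b = b
imp3 vh _ = vh
imp3 v0 _ = vh

IsDFEval : (Formula → V3) → Set
IsDFEval v = (∀ A → v (¬' A) ≡ neg3 (v A))
           × (∀ A B → v (A ∧' B) ≡ min3 (v A) (v B))
           × (∀ A B → v (A ∨' B) ≡ max3 (v A) (v B))
           × (∀ A B → v (A ⇒ B) ≡ imp3 (v A) (v B))

Designated : V3 → Set
Designated v = v ≡ vh ⊎ v ≡ v1

DFTT-valid : Formula → Set
DFTT-valid C = ∀ (v : Formula → V3) → IsDFEval v → Designated (v C)

evalCL : (ℕ → Bool) → Formula → Bool
evalCL σ (var n)  = σ n
evalCL σ (¬' A)   = not (evalCL σ A)
evalCL σ (A ∧' B) = evalCL σ A ∧ evalCL σ B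
evalCL σ (A ∨' B) = evalCL σ A ∨ evalCL σ B
evalCL σ (A ⇒ B)  = not (evalCL σ A) ∨ evalCL σ B

_⊨CL_ : Formula → Formula → Set
A ⊨CL B = ∀ (σ : ℕ → Bool) → evalCL σ A ≡ true → evalCL σ B ≡ true

-- A three-valued value x is *approximated* by a Boolean b (x ≼ b) when the
-- classical values of x are respected: x = 1 forces b = true, x = 0 forces
-- b = false, and x = ½ constrains nothing.  Each DF connective on V3 maps
-- approximated arguments to an approximated result under the corresponding
-- Boolean connective (for ⇒ this uses that the DF conditional is ½ unless
-- its antecedent is 1).  Hence, by induction on formulae, any DF-evaluation v
-- is approximated by the classical valuation of its *crisp* variable part
-- (p ↦ true iff v(p) = 1).
--
-- For the theorem: v(A ⇒ B) is ½ unless v(A) = 1.  If v(A) = 1, then A is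
-- classically true under the crisp valuation, so B is too, and a value
-- approximated by true is 1 or ½, i.e. designated.
module Submission where

open import Defs
open import Data.Nat using (ℕ)
open import Data.Bool using (Bool; true; false; not; _∧_; _∨_)
open import Data.Bool.Properties using (∧-zeroʳ; ∨-zeroʳ)
open import Data.Product using (_,_)
open import Data.Sum using (inj₁; inj₂)
open import Data.Unit using (⊤; tt)
open import Function using (_∘_)
open import Relation.Binary.PropositionalEquality using (_≡_; refl; sym; subst)

_≼_ : V3 → Bool → Set
v0 ≼ b = b ≡ false
vh ≼ _ = ⊤
v1 ≼ b = b ≡ true

crisp : V3 → Bool
crisp v1 = true
crisp _  = false

crisp-≼ : ∀ x → x ≼ crisp x
crisp-≼ v0 = refl
crisp-≼ vh = tt
crisp-≼ v1 = refl

neg-≼ : ∀ x b → x ≼ b → neg3 x ≼ not b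
neg-≼ v0 .false refl = refl
neg-≼ vh b       tt   = tt
neg-≼ v1 .true  refl = refl

min-≼ : ∀ x y a b → x ≼ a → y ≼ b → min3 x y ≼ (a ∧ b)
min-≼ v0 y  .false b     refl _    = refl
min-≼ vh v0 a      .false _    refl = ∧-zeroʳ a
min-≼ vh vh a      b     _    _    = tt
min-≼ vh v1 a      b     _    _    = tt
min-≼ v1 y  .true  b     refl y≼b  = y≼b

max-≼ : ∀ x y a b → x ≼ a → y ≼ b → max3 x y ≼ (a ∨ b)
max-≼ v0 y  .false b     refl y≼b  = y≼b
max-≼ vh v0 a      b     _    _    = tt
max-≼ vh vh a      b     _    _    = tt
max-≼ vh v1 a      .true _    refl = ∨-zeroʳ a
max-≼ v1 y  .true  b     refl _    = refl

imp-≼ : ∀ x y a b → x ≼ a → y ≼ b → imp3 x y ≼ (not a ∨ b)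
imp-≼ v0 y a      b _    _   = tt
imp-≼ vh y a      b _    _   = tt
imp-≼ v1 y .true  b refl y≼b = y≼b

crispValuation : (Formula → V3) → ℕ → Bool
crispValuation v = crisp ∘ v ∘ var

approximation : ∀ v → IsDFEval v → ∀ C → v C ≼ evalCL (crispValuation v) C
approximation v (v¬ , v∧ , v∨ , v⇒) = go
  where
    ≼σ : Formula → V3 → Set
    ≼σ C x = x ≼ evalCL (crispValuation v) C

    go : ∀ C → ≼σ C (v C)
    go (var n)  = crisp-≼ (v (var n))
    go (¬' A)   = subst (≼σ (¬' A))   (sym (v¬ A))     (neg-≼ _ _ (go A))
    go (A ∧' B) = subst (≼σ (A ∧' B)) (sym (v∧ A B))   (min-≼ _ _ _ _ (go A) (go B))
    go (A ∨' B) = subst (≼σ (A ∨' B)) (sym (v∨ A B))   (max-≼ _ _ _ _ (go A) (go B))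
    go (A ⇒ B)  = subst (≼σ (A ⇒ B))  (sym (v⇒ A B))   (imp-≼ _ _ _ _ (go A) (go B))

≼true-designated : ∀ y → y ≼ true → Designated y
≼true-designated vh _ = inj₁ refl
≼true-designated v1 _ = inj₂ refl

imp3-designated : ∀ x y → (x ≡ v1 → Designated y) → Designated (imp3 x y)
imp3-designated v0 y _ = inj₁ refl
imp3-designated vh y _ = inj₁ refl
imp3-designated v1 y h = h refl

mainTheorem4 : ∀ (A B : Formula) → A ⊨CL B → DFTT-valid (A ⇒ B)
mainTheorem4 A B A⊨B v isEval@(_ , _ , _ , v⇒) =
  subst Designated (sym (v⇒ A B)) (imp3-designated (v A) (v B) consequent)
  where
    σ : ℕ → Bool
    σ = crispValuation v

    consequent : v A ≡ v1 → Designated (v B)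
    consequent vA≡1 =
      ≼true-designated (v B)
        (subst (v B ≼_) (A⊨B σ (subst (_≼ evalCL σ A) vA≡1 (approximation v isEval A)))
               (approximation v isEval B))
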